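{- Let $P=[a_1]\times\cdots\times[a_n]$, $I\in J(P)$, $v\in\{\pm1\}^n$ and $\gamma\in\{1,\dots,n\}$ with $v_\gamma=1$. Then the $(v,\gamma)$-recombination $\Delta^\gamma_v I=\bigcup_{j=1}^{a_\gamma}L^j_\gamma(\mathrm{Pro}_v^{j-1}(I))$ is an order ideal of $P$.
   Context: $[m]=\{1,\dots,m\}$; $P$ has the componentwise order, elements viewed as vectors in $\mathbb{Z}^n$; $J(P)$ is the set of order ideals of $P$. The toggle $t_e(I)$ is $I\cup\{e\}$ if $e\notin I$ and this is an order ideal, $I\setminus\{e\}$ if $e\in I$ and this is an order ideal, and $I$ otherwise. For $v\in\{\pm1\}^n$, $T^i_v$ is the (commuting) product of toggles $t_x$ over $x\in P$ with $\langle x,v\rangle=i$, and $\mathrm{Pro}_v=\cdots T^{ -1}_vT^0_vT^1_v\cdots$ applies the $T^i_v$ in decreasing order of $i$. For $I\in J(P)$, the $j$-th $\gamma$-layer of $I$ is $L^j_\gamma(I)=\{x\in I: x_\gamma=j\}$. -}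

module Defs where

open import Data.Nat using (ℕ; zero; suc; _≤_; _≤ᵇ_; _≡ᵇ_)
open import Data.Integer as ℤ using (ℤ; +_; _-_)
open import Data.Bool using (Bool; true; false; _∧_; _∨_; not; if_then_else_)
open import Data.Sign using (Sign)
open import Data.Fin using (Fin)
open import Data.Vec using (Vec; []; _∷_; lookup)
open import Data.Vec.Relation.Binary.Pointwise.Inductive using (Pointwise)
open import Data.List using (List; []; _∷_; [_]; map; concatMap; upTo; foldr; foldl; filterᵇ)
open import Data.Bool.ListAction using (and; or)
open import Data.Product using (_×_)
open import Relation.Nullary.Decidable using (⌊_⌋)
open import Relation.Binary.PropositionalEquality using (_≡_)

-- Elements of P = [a₁] × ⋯ × [aₙ] are vectors x ∈ ℕⁿ with 1 ≤ xᵢ ≤ aᵢ.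
Elt : ℕ → Set
Elt n = Vec ℕ n

InP : ∀ {n} → Vec ℕ n → Elt n → Set
InP a x = Pointwise (λ ai xi → 1 ≤ xi × xi ≤ ai) a x

_≼_ : ∀ {n} → Elt n → Elt n → Set
x ≼ y = Pointwise _≤_ x y

Subset : ℕ → Set
Subset n = Elt n → Bool

IsOrderIdeal : ∀ {n} → Vec ℕ n → Subset n → Set
IsOrderIdeal a S =
  (∀ x → S x ≡ true → InP a x) ×
  (∀ x y → InP a y → y ≼ x → S x ≡ true → S y ≡ true)

elemsP : ∀ {n} → Vec ℕ n → List (Elt n)
elemsP [] = [ [] ]
elemsP (a ∷ as) = concatMap (λ k → map (suc k ∷_) (elemsP as)) (upTo a)

leB : ∀ {n} → Elt n → Elt n → Bool
leB [] [] = true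
leB (x ∷ xs) (y ∷ ys) = (x ≤ᵇ y) ∧ leB xs ys

eqB : ∀ {n} → Elt n → Elt n → Bool
eqB [] [] = true
eqB (x ∷ xs) (y ∷ ys) = (x ≡ᵇ y) ∧ eqB xs ys

-- decision of "S is an order ideal of P" (S ⊆ P holds for all uses below,
-- since S is an order ideal and the toggled element e lies in P)
downClosedB : ∀ {n} → Vec ℕ n → Subset n → Bool
downClosedB a S =
  and (map (λ x → and (map (λ y → not (leB y x ∧ S x) ∨ S y) (elemsP a))) (elemsP a))

toggle : ∀ {n} → Vec ℕ n → Elt n → Subset n → Subset n
toggle a e S =
  if S e
  then (if downClosedB a Sminus then Sminus else S)
  else (if downClosedB a Splus then Splus else S)
  where
  Splus : Subset _
  Splus x = S x ∨ eqB x e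
  Sminus : Subset _
  Sminus x = S x ∧ not (eqB x e)

signed : Sign → ℕ → ℤ
signed Sign.+ k = + k
signed Sign.- k = ℤ.- (+ k)

ip : ∀ {n} → Elt n → Vec Sign n → ℤ
ip [] [] = + 0
ip (x ∷ xs) (s ∷ ss) = signed s x ℤ.+ ip xs ss

Tv : ∀ {n} → Vec ℕ n → Vec Sign n → ℤ → Subset n → Subset n
Tv a v i S = foldr (toggle a) S (filterᵇ (λ x → ⌊ ip x v ℤ.≟ i ⌋) (elemsP a))

sumV : ∀ {n} → Vec ℕ n → ℕ
sumV [] = 0
sumV (x ∷ xs) = x Data.Nat.+ sumV xs

-- Pro_v: apply T^i_v for i = M, M-1, …, -M (M = Σ aᵢ bounds |⟨x,v⟩| on P;
-- T^i_v is the identity outside this range)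
Pro : ∀ {n} → Vec ℕ n → Vec Sign n → Subset n → Subset n
Pro a v S = foldl (λ T i → Tv a v i T) S
  (map (λ k → + M - + k) (upTo (suc (M Data.Nat.+ M))))
  where M = sumV a

iter : ∀ {A : Set} → ℕ → (A → A) → A → A
iter zero f x = x
iter (suc k) f x = f (iter k f x)

layer : ∀ {n} → Fin n → ℕ → Subset n → Subset n
layer γ j S x = S x ∧ (lookup x γ ≡ᵇ j)

recomb : ∀ {n} → Vec ℕ n → Vec Sign n → Fin n → Subset n → Subset n
recomb a v γ I x =
  or (map (λ k → layer γ (suc k) (iter k (Pro a v) I) x) (upTo (lookup a γ)))

-- Toggles, hence T^i_v and Pro_v, preserve order ideals, and t_e only changes the
-- membership of e.  As Pro_v toggles the levels ⟨·,v⟩ from the top down, the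
-- membership of y is settled before the level of any x ≼ y with ⟨x,v⟩ < ⟨y,v⟩ is
-- reached, at which point it still required x: so y ∈ Pro_v J implies x ∈ J.
-- Since v_γ = 1, lowering a γ-coordinate lowers ⟨·,v⟩; thus if y ∈ Pro_v^j I and
-- y_γ = j + 1, then y − e_γ ∈ Pro_v^{j-1} I.  Now let z ≼ w with w in the
-- (j+1)-th γ-layer of Pro_v^j I.  Raising z_γ to j + 1 keeps z below w, hence in
-- Pro_v^j I, and lowering it back to z_γ one step at a time lands z in
-- Pro_v^{z_γ - 1} I, i.e. in the recombination.
module Submission where

open import Defs
open import Data.Nat using (ℕ; zero; suc; pred; _+_; _≤_; _<_; z≤n; s≤s; s≤s⁻¹; >-nonZero; _≡ᵇ_; _≤′_; ≤′-refl; ≤′-step)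
import Data.Nat.Properties as ℕ
open import Data.Integer as ℤ using (ℤ; +_; _-_; +<+)
import Data.Integer.Properties as ℤ
open import Data.Bool using (Bool; true; false; _∧_; _∨_; not; if_then_else_; T?)
open import Data.Bool.Properties using (∧-conicalˡ; ∧-conicalʳ; ∧-identityʳ; ∨-identityʳ; ∨-zeroʳ; T-≡)
open import Data.Bool.ListAction using (and; or)
open import Data.Fin using (Fin; zero; suc)
open import Data.Vec using (Vec; []; _∷_; lookup; _[_]≔_)
open import Data.Vec.Properties using ([]≔-idempotent; []≔-lookup; lookup∘update)
open import Data.Vec.Relation.Binary.Pointwise.Inductive as Pointwise using (Pointwise; []; _∷_)
open import Data.List using (List; []; _∷_; map; upTo; foldr; foldl; filterᵇ)
open import Data.List.Relation.Unary.All as All using (All; []; _∷_)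
open import Data.List.Relation.Unary.AllPairs using (AllPairs; []; _∷_)
import Data.List.Relation.Unary.AllPairs.Properties as AllPairs
open import Data.List.Relation.Unary.Any using (here; there)
open import Data.List.Membership.Propositional using (_∈_)
open import Data.List.Membership.Propositional.Properties
  using (∈-map⁺; ∈-map⁻; ∈-concat⁺′; ∈-concat⁻′; ∈-upTo⁺; ∈-upTo⁻; ∈-filter⁻)
open import Data.Product using (_×_; _,_; proj₁; proj₂; ∃-syntax)
open import Data.Sum using (_⊎_; inj₁; inj₂)
open import Data.Sign using (Sign)
open import Function using (_∘_; flip)
open import Function.Bundles using (Equivalence)
open import Relation.Nullary using (yes; no; contradiction)
open import Relation.Nullary.Decidable using (⌊_⌋; toWitness)
open import Relation.Binary.PropositionalEquality using (_≡_; _≢_; refl; sym; trans; cong; cong₂; subst; subst₂; module ≡-Reasoning)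

private
  variable
    n : ℕ

∨-true⁻ : ∀ x {y} → x ∨ y ≡ true → x ≡ true ⊎ y ≡ true
∨-true⁻ true  _ = inj₁ refl
∨-true⁻ false p = inj₂ p

and-map⁻ : ∀ {A : Set} (f : A → Bool) {xs x} → and (map f xs) ≡ true → x ∈ xs → f x ≡ true
and-map⁻ f {y ∷ ys} p (here refl) = ∧-conicalˡ (f y) _ p
and-map⁻ f {y ∷ ys} p (there x∈ys) = and-map⁻ f (∧-conicalʳ (f y) _ p) x∈ys

or-map⁻ : ∀ {A : Set} (f : A → Bool) xs → or (map f xs) ≡ true → ∃[ x ] x ∈ xs × f x ≡ true
or-map⁻ f (y ∷ ys) p with ∨-true⁻ (f y) p
... | inj₁ fy = y , here refl , fy
... | inj₂ rest with or-map⁻ f ys rest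
...   | x , x∈ys , fx = x , there x∈ys , fx

or-map⁺ : ∀ {A : Set} (f : A → Bool) {xs x} → x ∈ xs → f x ≡ true → or (map f xs) ≡ true
or-map⁺ f (here refl) fx rewrite fx = refl
or-map⁺ f {y ∷ _} (there x∈ys) fx rewrite or-map⁺ f x∈ys fx = ∨-zeroʳ (f y)

eqB⇒≡ : (x y : Elt n) → eqB x y ≡ true → x ≡ y
eqB⇒≡ [] [] _ = refl
eqB⇒≡ (x ∷ xs) (y ∷ ys) p =
  cong₂ _∷_ (ℕ.≡ᵇ⇒≡ x y (Equivalence.from T-≡ (∧-conicalˡ (x ≡ᵇ y) _ p)))
            (eqB⇒≡ xs ys (∧-conicalʳ (x ≡ᵇ y) _ p))

≢⇒eqB≡false : (x y : Elt n) → x ≢ y → eqB x y ≡ false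
≢⇒eqB≡false x y x≢y with eqB x y in eq
... | true  = contradiction (eqB⇒≡ x y eq) x≢y
... | false = refl

≼⇒leB : {x y : Elt n} → x ≼ y → leB x y ≡ true
≼⇒leB [] = refl
≼⇒leB (x≤y ∷ xs≼ys) rewrite Equivalence.to T-≡ (ℕ.≤⇒≤ᵇ x≤y) = ≼⇒leB xs≼ys

∈-elemsP⁻ : (a : Vec ℕ n) {x : Elt n} → x ∈ elemsP a → InP a x
∈-elemsP⁻ [] {[]} _ = []
∈-elemsP⁻ (a ∷ as) x∈ with ∈-concat⁻′ (map (λ k → map (suc k ∷_) (elemsP as)) (upTo a)) x∈
... | _ , x∈row , row∈ with ∈-map⁻ (λ k → map (suc k ∷_) (elemsP as)) row∈
...   | k , k∈ , refl with ∈-map⁻ (suc k ∷_) x∈row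
...     | xs , xs∈ , refl = (s≤s z≤n , ∈-upTo⁻ k∈) ∷ ∈-elemsP⁻ as xs∈

∈-elemsP⁺ : (a : Vec ℕ n) {x : Elt n} → InP a x → x ∈ elemsP a
∈-elemsP⁺ [] [] = here refl
∈-elemsP⁺ (a ∷ as) {suc k ∷ xs} ((_ , k<a) ∷ xs∈P) =
  ∈-concat⁺′ (∈-map⁺ (suc k ∷_) (∈-elemsP⁺ as xs∈P))
             (∈-map⁺ (λ k → map (suc k ∷_) (elemsP as)) (∈-upTo⁺ k<a))

downClosedB-sound : (a : Vec ℕ n) (S : Subset n) → downClosedB a S ≡ true →
  ∀ {x y} → InP a x → InP a y → y ≼ x → S x ≡ true → S y ≡ true
downClosedB-sound a S dc {x} {y} x∈P y∈P y≼x Sx =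
  implied (leB y x) (S x) (≼⇒leB y≼x) Sx
    (and-map⁻ (λ y → not (leB y x ∧ S x) ∨ S y)
      (and-map⁻ (λ x → and (map (λ y → not (leB y x ∧ S x) ∨ S y) (elemsP a))) dc
        (∈-elemsP⁺ a x∈P))
      (∈-elemsP⁺ a y∈P))
  where
  implied : ∀ b c {d} → b ≡ true → c ≡ true → not (b ∧ c) ∨ d ≡ true → d ≡ true
  implied true true _ _ d = d

remove insert : Subset n → Elt n → Subset n
remove S e x = S x ∧ not (eqB x e)
insert S e x = S x ∨ eqB x e

data ToggleView (a : Vec ℕ n) (e : Elt n) (S : Subset n) : Subset n → Set where
  unchanged : ToggleView a e S S
  removed   : downClosedB a (remove S e) ≡ true → ToggleView a e S (remove S e)
  inserted  : downClosedB a (insert S e) ≡ true → ToggleView a e S (insert S e)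

toggleView : (a : Vec ℕ n) (e : Elt n) (S : Subset n) → ToggleView a e S (toggle a e S)
-- Generalising the three tests makes the conditionals in toggle compute.
toggleView a e S = view (S e) (downClosedB a (remove S e)) (downClosedB a (insert S e)) refl refl
  where
  view : ∀ b c d → downClosedB a (remove S e) ≡ c → downClosedB a (insert S e) ≡ d →
    ToggleView a e S (if b then (if c then remove S e else S) else (if d then insert S e else S))
  view true  true  _     dc _  = removed dc
  view true  false _     _  _  = unchanged
  view false _     true  _  dc = inserted dc
  view false _     false _  _  = unchanged

toggle-≢ : (a : Vec ℕ n) (e : Elt n) (S : Subset n) {z : Elt n} → z ≢ e → toggle a e S z ≡ S z
toggle-≢ a e S {z} z≢e with toggle a e S | toggleView a e S
... | _ | unchanged = refl
... | _ | removed _ rewrite ≢⇒eqB≡false z e z≢e = ∧-identityʳ (S z)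
... | _ | inserted _ rewrite ≢⇒eqB≡false z e z≢e = ∨-identityʳ (S z)

toggle-ideal : (a : Vec ℕ n) {e : Elt n} (S : Subset n) →
  InP a e → IsOrderIdeal a S → IsOrderIdeal a (toggle a e S)
toggle-ideal a {e} S e∈P (S⊆P , S↓) with toggle a e S | toggleView a e S
... | _ | unchanged = S⊆P , S↓
... | _ | removed dc = removed⊆P , λ x y y∈P y≼x Rx →
        downClosedB-sound a (remove S e) dc (removed⊆P x Rx) y∈P y≼x Rx
  where
  removed⊆P : ∀ x → remove S e x ≡ true → InP a x
  removed⊆P x Rx = S⊆P x (∧-conicalˡ (S x) _ Rx)
... | _ | inserted dc = inserted⊆P , λ x y y∈P y≼x Ix →
        downClosedB-sound a (insert S e) dc (inserted⊆P x Ix) y∈P y≼x Ix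
  where
  inserted⊆P : ∀ x → insert S e x ≡ true → InP a x
  inserted⊆P x Ix with ∨-true⁻ (S x) Ix
  ... | inj₁ Sx = S⊆P x Sx
  ... | inj₂ x≡e rewrite eqB⇒≡ x e x≡e = e∈P

module _ {n} (a : Vec ℕ n) where

  toggles-ideal : (es : List (Elt n)) (S : Subset n) → All (InP a) es →
    IsOrderIdeal a S → IsOrderIdeal a (foldr (toggle a) S es)
  toggles-ideal []       S []            S-ideal = S-ideal
  toggles-ideal (e ∷ es) S (e∈P ∷ es⊆P) S-ideal =
    toggle-ideal a (foldr (toggle a) S es) e∈P (toggles-ideal es S es⊆P S-ideal)

  toggles-∉ : (es : List (Elt n)) (S : Subset n) {z : Elt n} → All (z ≢_) es →
    foldr (toggle a) S es z ≡ S z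
  toggles-∉ []       S []            = refl
  toggles-∉ (e ∷ es) S (z≢e ∷ z∉es) =
    trans (toggle-≢ a e (foldr (toggle a) S es) z≢e) (toggles-∉ es S z∉es)

  module _ (v : Vec Sign n) where

    level : ℤ → List (Elt n)
    level i = filterᵇ (λ x → ⌊ ip x v ℤ.≟ i ⌋) (elemsP a)

    ∈-level⁻ : ∀ {i e} → e ∈ level i → InP a e × ip e v ≡ i
    ∈-level⁻ {i} {e} e∈ with ∈-filter⁻ (λ x → T? ⌊ ip x v ℤ.≟ i ⌋) e∈
    ... | e∈P , atLevel = ∈-elemsP⁻ a e∈P , toWitness atLevel

    Tv-ideal : ∀ i (S : Subset n) → IsOrderIdeal a S → IsOrderIdeal a (Tv a v i S)
    Tv-ideal i S = toggles-ideal (level i) S (All.tabulate (λ e∈ → proj₁ (∈-level⁻ e∈)))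

    Tv-≢ : ∀ i (S : Subset n) {z} → ip z v ≢ i → Tv a v i S z ≡ S z
    Tv-≢ i S {z} z∉level = toggles-∉ (level i) S
      (All.tabulate λ e∈ z≡e → z∉level (trans (cong (λ w → ip w v) z≡e) (proj₂ (∈-level⁻ e∈))))

    step : Subset n → ℤ → Subset n
    step S i = Tv a v i S

    steps-ideal : ∀ is (S : Subset n) → IsOrderIdeal a S → IsOrderIdeal a (foldl step S is)
    steps-ideal []       S S-ideal = S-ideal
    steps-ideal (i ∷ is) S S-ideal = steps-ideal is (step S i) (Tv-ideal i S S-ideal)

    steps-∉ : ∀ is (S : Subset n) {z} → All (_≢ ip z v) is → foldl step S is z ≡ S z
    steps-∉ []       S []                = refl
    steps-∉ (i ∷ is) S (i≢z ∷ z∉is) = trans (steps-∉ is (step S i) z∉is) (Tv-≢ i S (i≢z ∘ sym))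

    -- When the level of x is processed, the remaining levels lie below that of y,
    -- so y keeps its current membership, which already required x.
    steps-below : ∀ is (S : Subset n) → AllPairs (flip ℤ._<_) is → IsOrderIdeal a S →
      ∀ {x y} → InP a x → x ≼ y → ip x v ℤ.< ip y v → foldl step S is y ≡ true → S x ≡ true
    steps-below [] S [] (_ , S↓) x∈P x≼y _ Sy = S↓ _ _ x∈P x≼y Sy
    steps-below (i ∷ is) S (below-i ∷ descending) S-ideal {x} {y} x∈P x≼y x<y Sy
      with i ℤ.≟ ip x v
    ... | yes refl = proj₂ S-ideal y x x∈P x≼y (begin
          S y                     ≡⟨ Tv-≢ i S (λ y≡i → ℤ.<-irrefl (sym y≡i) x<y) ⟨
          step S i y              ≡⟨ steps-∉ is (step S i) y∉rest ⟨
          foldl step S (i ∷ is) y ≡⟨ Sy ⟩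
          true                    ∎)
      where
      open ≡-Reasoning
      y∉rest : All (_≢ ip y v) is
      y∉rest = All.map (λ j<i j≡y → ℤ.<-irrefl j≡y (ℤ.<-trans j<i x<y)) below-i
    ... | no i≢x = trans (sym (Tv-≢ i S (i≢x ∘ sym)))
          (steps-below is (step S i) descending (Tv-ideal i S S-ideal) x∈P x≼y x<y Sy)

  levels : List ℤ
  levels = map (λ k → + sumV a - + k) (upTo (suc (sumV a + sumV a)))

  levels-descending : AllPairs (flip ℤ._<_) levels
  levels-descending = AllPairs.map⁺ (AllPairs.applyUpTo⁺₁ (λ k → k) _
    (λ j<k _ → ℤ.+-monoʳ-< (+ sumV a) (ℤ.neg-mono-< (+<+ j<k))))

  module _ (v : Vec Sign n) where

    Pro-ideal : (S : Subset n) → IsOrderIdeal a S → IsOrderIdeal a (Pro a v S)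
    Pro-ideal = steps-ideal v levels

    iter-Pro-ideal : ∀ k (S : Subset n) → IsOrderIdeal a S → IsOrderIdeal a (iter k (Pro a v) S)
    iter-Pro-ideal zero    S S-ideal = S-ideal
    iter-Pro-ideal (suc k) S S-ideal = Pro-ideal _ (iter-Pro-ideal k S S-ideal)

    Pro-below : (J : Subset n) → IsOrderIdeal a J → ∀ {x y} → InP a x → x ≼ y →
      ip x v ℤ.< ip y v → Pro a v J y ≡ true → J x ≡ true
    Pro-below J = steps-below v levels J levels-descending

Pointwise-[]≔ : ∀ {A B : Set} {R : A → B → Set} {xs ys} (i : Fin n) {c d} →
  Pointwise R xs ys → R c d → Pointwise R (xs [ i ]≔ c) (ys [ i ]≔ d)
Pointwise-[]≔ zero    (_ ∷ rs) r = r ∷ rs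
Pointwise-[]≔ (suc i) (r ∷ rs) r′ = r ∷ Pointwise-[]≔ i rs r′

InP-[]≔ : (a : Vec ℕ n) (γ : Fin n) {x : Elt n} {c : ℕ} →
  InP a x → 1 ≤ c → c ≤ lookup a γ → InP a (x [ γ ]≔ c)
InP-[]≔ a γ x∈P 1≤c c≤aγ =
  subst (λ b → InP b _) ([]≔-lookup a γ) (Pointwise-[]≔ γ x∈P (1≤c , c≤aγ))

InP-[]≔-lower : (a : Vec ℕ n) (γ : Fin n) {x : Elt n} {c d : ℕ} →
  InP a (x [ γ ]≔ c) → 1 ≤ d → d ≤ c → InP a (x [ γ ]≔ d)
InP-[]≔-lower a γ {x} {c} {d} x∈P 1≤d d≤c = subst (InP a) ([]≔-idempotent x γ)
  (InP-[]≔ a γ x∈P 1≤d (ℕ.≤-trans d≤c (subst (_≤ lookup a γ) (lookup∘update γ x c)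
    (proj₂ (Pointwise.lookup x∈P γ)))))

≼-[]≔-suc : (γ : Fin n) (x : Elt n) (c : ℕ) → (x [ γ ]≔ c) ≼ (x [ γ ]≔ suc c)
≼-[]≔-suc γ x c = Pointwise-[]≔ γ (Pointwise.refl ℕ.≤-refl) (ℕ.n≤1+n c)

ip-[]≔-suc : (v : Vec Sign n) (γ : Fin n) (x : Elt n) (c : ℕ) → lookup v γ ≡ Sign.+ →
  ip (x [ γ ]≔ c) v ℤ.< ip (x [ γ ]≔ suc c) v
ip-[]≔-suc (Sign.+ ∷ vs) zero    (_ ∷ xs) c refl = ℤ.+-monoˡ-< (ip xs vs) (+<+ (ℕ.n<1+n c))
ip-[]≔-suc (s ∷ vs)      (suc γ) (x ∷ xs) c vγ   = ℤ.+-monoʳ-< (signed s x) (ip-[]≔-suc vs γ xs c vγ)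

Pro-[]≔-pred : (a : Vec ℕ n) (v : Vec Sign n) (γ : Fin n) → lookup v γ ≡ Sign.+ →
  (J : Subset n) → IsOrderIdeal a J → ∀ {x c} → InP a (x [ γ ]≔ c) →
  Pro a v J (x [ γ ]≔ suc c) ≡ true → J (x [ γ ]≔ c) ≡ true
Pro-[]≔-pred a v γ vγ J J-ideal {x} {c} x∈P =
  Pro-below a v J J-ideal x∈P (≼-[]≔-suc γ x c) (ip-[]≔-suc v γ x c vγ)

module Recombination {n} (a : Vec ℕ n) (v : Vec Sign n) (γ : Fin n) (vγ : lookup v γ ≡ Sign.+)
  (I : Subset n) (I-ideal : IsOrderIdeal a I) where

  J : ℕ → Subset n
  J k = iter k (Pro a v) I

  J-ideal : ∀ k → IsOrderIdeal a (J k)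
  J-ideal k = iter-Pro-ideal a v k I I-ideal

  ∈-recomb⁻ : ∀ {w} → recomb a v γ I w ≡ true →
    ∃[ k ] k < lookup a γ × lookup w γ ≡ suc k × J k w ≡ true
  ∈-recomb⁻ {w} w∈ with or-map⁻ (λ k → layer γ (suc k) (J k) w) (upTo (lookup a γ)) w∈
  ... | k , k∈ , w∈layer = k , ∈-upTo⁻ k∈ ,
    ℕ.≡ᵇ⇒≡ _ _ (Equivalence.from T-≡ (∧-conicalʳ (J k w) _ w∈layer)) , ∧-conicalˡ (J k w) _ w∈layer

  ∈-recomb⁺ : ∀ {w k} → k < lookup a γ → lookup w γ ≡ suc k → J k w ≡ true → recomb a v γ I w ≡ true
  ∈-recomb⁺ {w} {k} k<aγ wγ≡ Jkw = or-map⁺ (λ k → layer γ (suc k) (J k) w) (∈-upTo⁺ k<aγ)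
    (cong₂ _∧_ Jkw (Equivalence.to T-≡ (ℕ.≡⇒≡ᵇ _ _ wγ≡)))

  descend : ∀ {k′ k x} → k′ ≤′ k → InP a (x [ γ ]≔ suc k) →
    J k (x [ γ ]≔ suc k) ≡ true → J k′ (x [ γ ]≔ suc k′) ≡ true
  descend ≤′-refl _ Jx = Jx
  descend {k = suc k} {x} (≤′-step k′≤k) x∈P Jx =
    descend k′≤k x↓∈P (Pro-[]≔-pred a v γ vγ (J k) (J-ideal k) x↓∈P Jx)
    where
    x↓∈P : InP a (x [ γ ]≔ suc k)
    x↓∈P = InP-[]≔-lower a γ x∈P (s≤s z≤n) (ℕ.n≤1+n (suc k))

  suc-pred-γ : ∀ {z} → InP a z → lookup z γ ≡ suc (pred (lookup z γ))
  suc-pred-γ z∈P = sym (ℕ.suc-pred _ {{>-nonZero (proj₁ (Pointwise.lookup z∈P γ))}})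

  layer-below : ∀ {w z k} → InP a w → lookup w γ ≡ suc k → J k w ≡ true →
    InP a z → z ≼ w → J (pred (lookup z γ)) z ≡ true
  layer-below {w} {z} {k} w∈P wγ≡ Jkw z∈P z≼w =
    subst (λ y → J k′ y ≡ true) z[γ]≔zγ
      (descend (ℕ.≤⇒≤′ k′≤k) z↑∈P (proj₂ (J-ideal k) w _ z↑∈P z↑≼w Jkw))
    where
    k′ : ℕ
    k′ = pred (lookup z γ)
    z↑∈P : InP a (z [ γ ]≔ suc k)
    z↑∈P = InP-[]≔ a γ z∈P (s≤s z≤n)
      (subst (_≤ lookup a γ) wγ≡ (proj₂ (Pointwise.lookup w∈P γ)))
    z↑≼w : (z [ γ ]≔ suc k) ≼ w
    z↑≼w = subst (λ y → (z [ γ ]≔ suc k) ≼ y) ([]≔-lookup w γ)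
      (Pointwise-[]≔ γ z≼w (subst (suc k ≤_) (sym wγ≡) ℕ.≤-refl))
    k′≤k : k′ ≤ k
    k′≤k = s≤s⁻¹ (subst₂ _≤_ (suc-pred-γ z∈P) wγ≡ (Pointwise.lookup z≼w γ))
    z[γ]≔zγ : z [ γ ]≔ suc k′ ≡ z
    z[γ]≔zγ = trans (cong (z [ γ ]≔_) (sym (suc-pred-γ z∈P))) ([]≔-lookup z γ)

  recomb-ideal : IsOrderIdeal a (recomb a v γ I)
  recomb-ideal = recomb⊆P , recomb↓
    where
    recomb⊆P : ∀ w → recomb a v γ I w ≡ true → InP a w
    recomb⊆P w w∈ with k , _ , _ , Jkw ← ∈-recomb⁻ w∈ = proj₁ (J-ideal k) w Jkw

    recomb↓ : ∀ w z → InP a z → z ≼ w → recomb a v γ I w ≡ true → recomb a v γ I z ≡ true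
    recomb↓ w z z∈P z≼w w∈ with k , _ , wγ≡ , Jkw ← ∈-recomb⁻ w∈ =
      ∈-recomb⁺ (subst (_≤ lookup a γ) (suc-pred-γ z∈P) (proj₂ (Pointwise.lookup z∈P γ)))
        (suc-pred-γ z∈P) (layer-below (recomb⊆P w w∈) wγ≡ Jkw z∈P z≼w)

lemma4p4 : ∀ {n} (a : Vec ℕ n) (I : Subset n) (v : Vec Sign n) (γ : Fin n) →
    lookup v γ ≡ Sign.+ → IsOrderIdeal a I → IsOrderIdeal a (recomb a v γ I)
lemma4p4 a I v γ vγ I-ideal = Recombination.recomb-ideal a v γ vγ I I-ideal
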